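{- If $k$ is a Gaussian integer with $\operatorname{Im}k\neq0$, then $\dfrac{|16k^3-4k|}{|k-1|}\notin\mathbb{Q}$. -}

module Defs where

open import Data.Integer using (ℤ; +_; _+_; _-_; _*_; -_)

record ℤ[i] : Set where
  constructor _+_i
  field
    re : ℤ
    im : ℤ
open ℤ[i] public

infixl 6 _+ᵍ_ _-ᵍ_
infixl 7 _*ᵍ_

_+ᵍ_ : ℤ[i] → ℤ[i] → ℤ[i]
(a + b i) +ᵍ (c + d i) = (a + c) + (b + d) i

_-ᵍ_ : ℤ[i] → ℤ[i] → ℤ[i]
(a + b i) -ᵍ (c + d i) = (a - c) + (b - d) i

_*ᵍ_ : ℤ[i] → ℤ[i] → ℤ[i]
(a + b i) *ᵍ (c + d i) = (a * c - b * d) + (a * d + b * c) i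

ι : ℤ → ℤ[i]
ι n = n + (+ 0) i

-- field norm N(a + b i) = a² + b² = |a + b i|²
N : ℤ[i] → ℤ
N (a + b i) = a * a + b * b

f : ℤ[i] → ℤ[i]
f k = ι (+ 16) *ᵍ k *ᵍ k *ᵍ k -ᵍ ι (+ 4) *ᵍ k

-- Put w = 4k² − 2k − 1, so that f k · (k − 1) = 4k(2k − 1)(2k + 1)(k − 1) = (w + 1)(w − 1) = w² − 1
-- and hence N (f k) · N (k − 1) = N (w² − 1). Writing w = x + y i,
--   N (w² − 1) = (N w − 1)² + 4y² = (N w + 1)² − 4x²,
-- so when x, y ≠ 0 it lies strictly between (N w − 1)² and (N w + 1)²; it is not (N w)² either,
-- since (N w)² − (N w − 1)² is odd and 4y² is even. For k = a + b i, x is odd and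
-- y = 2b(4a − 1) ≠ 0 as b ≠ 0. On the other hand, if |f k| / |k − 1| = n / d in lowest terms,
-- then n² N (k − 1) = d² N (f k), and coprimality forces N (f k) · N (k − 1) to be a square.
module Submission where

open import Defs
open import Data.Product using (∃; ∃-syntax; _×_; _,_)
open import Data.List using (_∷_; [])
open import Function using (_∘_)
open import Relation.Binary.PropositionalEquality
open import Relation.Nullary using (¬_)

module Squares where
  open import Data.Nat
  open import Data.Nat.Properties
  open import Data.Nat.Divisibility
  open import Data.Nat.Coprimality using (Coprime; coprime-divisor)
  open import Data.Nat.Tactic.RingSolver using (solve)
  open ≡-Reasoning

  IsSquare : ℕ → Set
  IsSquare n = ∃[ m ] n ≡ m * m

  m*m<n*n⇒m<n : ∀ {m n} → m * m < n * n → m < n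
  m*m<n*n⇒m<n m*m<n*n = ≰⇒> (λ n≤m → <⇒≱ m*m<n*n (*-mono-≤ n≤m n≤m))

  t*t<m*m<[2+t]*[2+t]⇒m≡1+t : ∀ {m t} → t * t < m * m → m * m < (2 + t) * (2 + t) → m ≡ suc t
  t*t<m*m<[2+t]*[2+t]⇒m≡1+t t*t<m*m m*m<[2+t]² =
    ≤-antisym (≤-pred (m*m<n*n⇒m<n m*m<[2+t]²)) (m*m<n*n⇒m<n t*t<m*m)

  [1+t]*[1+t]≢t*t+4*v : ∀ t v → suc t * suc t ≢ t * t + 4 * v
  [1+t]*[1+t]≢t*t+4*v t v eq = even≢odd (2 * v) t (sym (begin
    suc (2 * t)  ≡⟨ +-cancelˡ-≡ (t * t) _ _ t*t+[1+2t]≡t*t+4v ⟩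
    4 * v        ≡⟨ *-assoc 2 2 v ⟩
    2 * (2 * v)  ∎))
    where
    t*t+[1+2t]≡t*t+4v : t * t + suc (2 * t) ≡ t * t + 4 * v
    t*t+[1+2t]≡t*t+4v = begin
      t * t + suc (2 * t)  ≡⟨ solve (t ∷ []) ⟩
      suc t * suc t        ≡⟨ eq ⟩
      t * t + 4 * v        ∎

  ¬IsSquare[t*t+4*[1+v]] : ∀ t u v → t * t + 4 * suc v + 4 * suc u ≡ (2 + t) * (2 + t) →
                           ¬ IsSquare (t * t + 4 * suc v)
  ¬IsSquare[t*t+4*[1+v]] t u v upper (m , p≡m*m) = [1+t]*[1+t]≢t*t+4*v t (suc v) (begin
    suc t * suc t        ≡⟨ cong (λ n → n * n) m≡1+t ⟨
    m * m                ≡⟨ p≡m*m ⟨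
    t * t + 4 * suc v    ∎)
    where
    p = t * t + 4 * suc v
    m≡1+t : m ≡ suc t
    m≡1+t = t*t<m*m<[2+t]*[2+t]⇒m≡1+t
      (subst (t * t <_) p≡m*m (m<m+n (t * t) z<s))
      (subst (_< (2 + t) * (2 + t)) p≡m*m (subst (p <_) upper (m<m+n p z<s)))

  coprime-divisor² : ∀ {d n o} → Coprime d n → d ∣ n * n * o → d ∣ o
  coprime-divisor² {d} {n} {o} c d∣n*n*o =
    coprime-divisor c (coprime-divisor c (subst (d ∣_) (*-assoc n n o) d∣n*n*o))

  d*d∣n*n*o⇒d*d∣o : ∀ {d n o} .{{_ : NonZero d}} → Coprime d n → d * d ∣ n * n * o → d * d ∣ o
  d*d∣n*n*o⇒d*d∣o {d} {n} c d*d∣n*n*o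
    with divides e refl ← coprime-divisor² c (m*n∣⇒m∣ d d d*d∣n*n*o)
    = *-monoˡ-∣ d (coprime-divisor² c (*-cancelʳ-∣ d d*d∣n*n*e*d))
    where
    d*d∣n*n*e*d : d * d ∣ n * n * e * d
    d*d∣n*n*e*d = subst (d * d ∣_) (sym (*-assoc (n * n) e d)) d*d∣n*n*o

  n*n*D≡F*[d*d]⇒IsSquare[F*D] : ∀ {d n D F} .{{_ : NonZero d}} → Coprime d n →
                                 n * n * D ≡ F * (d * d) → IsSquare (F * D)
  n*n*D≡F*[d*d]⇒IsSquare[F*D] {d} {n} {D} {F} c eq
    with divides e refl ← d*d∣n*n*o⇒d*d∣o c (divides F eq)
    = n * e * d , (begin
      F * (e * (d * d))          ≡⟨ cong (_* (e * (d * d))) F≡n*n*e ⟩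
      n * n * e * (e * (d * d))  ≡⟨ solve (n ∷ e ∷ d ∷ []) ⟩
      n * e * d * (n * e * d)    ∎)
    where
    instance _ = m*n≢0 d d
    F≡n*n*e : F ≡ n * n * e
    F≡n*n*e = *-cancelʳ-≡ F (n * n * e) (d * d)
                (trans (sym eq) (sym (*-assoc (n * n) e (d * d))))

module RationalSquares where
  open Squares using (IsSquare; n*n*D≡F*[d*d]⇒IsSquare[F*D])
  open import Data.Integer as ℤ using (+_; ∣_∣)
  import Data.Integer.Properties as ℤ
  import Data.Nat as ℕ
  import Data.Nat.Properties as ℕ
  import Data.Nat.Coprimality as Coprime
  open import Data.Rational using (mkℚ; ↥_; ↧ₙ_; toℚᵘ; _*_; _/_)
  open import Data.Rational.Properties using (toℚᵘ-fromℚᵘ; toℚᵘ-homo-*; toℚᵘ-cong)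
  import Data.Rational.Unnormalised as ℚᵘ
  import Data.Rational.Unnormalised.Properties as ℚᵘ
  open ≡-Reasoning

  toℚᵘ[j/1]≃j : ∀ j → toℚᵘ (j / 1) ℚᵘ.≃ ℚᵘ.mkℚᵘ j 0
  toℚᵘ[j/1]≃j j = toℚᵘ-fromℚᵘ (ℚᵘ.mkℚᵘ j 0)

  q*q*D≡F⇒↥q*↥q*D≡F*↧q*↧q : ∀ q D F → q * q * (D / 1) ≡ F / 1 →
                              ↥ q ℤ.* ↥ q ℤ.* D ≡ F ℤ.* + (↧ₙ q ℕ.* ↧ₙ q)
  q*q*D≡F⇒↥q*↥q*D≡F*↧q*↧q q@record{} D F eq = begin
    ↥ q ℤ.* ↥ q ℤ.* D                 ≡⟨ ℤ.*-identityʳ _ ⟨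
    ↥ q ℤ.* ↥ q ℤ.* D ℤ.* + 1         ≡⟨ ℚᵘ.drop-*≡* q*q*D≃F ⟩
    F ℤ.* + (↧ₙ q ℕ.* ↧ₙ q ℕ.* 1)     ≡⟨ cong (λ n → F ℤ.* + n) (ℕ.*-identityʳ _) ⟩
    F ℤ.* + (↧ₙ q ℕ.* ↧ₙ q)           ∎
    where
    q*q*D≃F : toℚᵘ q ℚᵘ.* toℚᵘ q ℚᵘ.* ℚᵘ.mkℚᵘ D 0 ℚᵘ.≃ ℚᵘ.mkℚᵘ F 0
    q*q*D≃F = ℚᵘ.≃-trans
      (ℚᵘ.≃-sym (ℚᵘ.≃-trans (toℚᵘ-homo-* (q * q) (D / 1))
                            (ℚᵘ.*-cong (toℚᵘ-homo-* q q) (toℚᵘ[j/1]≃j D))))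
      (ℚᵘ.≃-trans (toℚᵘ-cong eq) (toℚᵘ[j/1]≃j F))

  q*q*D≡F⇒IsSquare∣F*D∣ : ∀ q D F → q * q * (D / 1) ≡ F / 1 → IsSquare ∣ F ℤ.* D ∣
  q*q*D≡F⇒IsSquare∣F*D∣ q@(mkℚ n d-1 n⊥d) D F eq = subst IsSquare (sym (ℤ.abs-* F D))
    (n*n*D≡F*[d*d]⇒IsSquare[F*D] {F = ∣ F ∣} (Coprime.sym (Coprime.recompute n⊥d))
                                 ∣n∣*∣n∣*∣D∣≡∣F∣*[d*d])
    where
    d = ℕ.suc d-1
    ∣n∣*∣n∣*∣D∣≡∣F∣*[d*d] : ∣ n ∣ ℕ.* ∣ n ∣ ℕ.* ∣ D ∣ ≡ ∣ F ∣ ℕ.* (d ℕ.* d)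
    ∣n∣*∣n∣*∣D∣≡∣F∣*[d*d] = begin
      ∣ n ∣ ℕ.* ∣ n ∣ ℕ.* ∣ D ∣   ≡⟨ cong (ℕ._* ∣ D ∣) (ℤ.abs-* n n) ⟨
      ∣ n ℤ.* n ∣ ℕ.* ∣ D ∣       ≡⟨ ℤ.abs-* (n ℤ.* n) D ⟨
      ∣ n ℤ.* n ℤ.* D ∣           ≡⟨ cong ∣_∣ (q*q*D≡F⇒↥q*↥q*D≡F*↧q*↧q q D F eq) ⟩
      ∣ F ℤ.* + (d ℕ.* d) ∣       ≡⟨ ℤ.abs-* F (+ (d ℕ.* d)) ⟩
      ∣ F ∣ ℕ.* (d ℕ.* d)         ∎

module GaussianIntegers where
  open Squares using (IsSquare; ¬IsSquare[t*t+4*[1+v]])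
  open import Data.Integer
  open import Data.Integer.Properties using (abs-*; pos-*; +-injective; +◃n≡+n; i*j≡0⇒i≡0∨j≡0)
  open import Data.Integer.Tactic.RingSolver using (solve-∀; solve)
  import Data.Nat as ℕ
  import Data.Nat.Properties as ℕ
  open import Data.Sum using ([_,_]′)
  open import Relation.Nullary using (contradiction)
  open ≡-Reasoning

  -- The ring solver reads re and im of a compound Gaussian integer as opaque constants, so each
  -- identity below is stated on the components as they unfold, e.g. with the + 0 parts of ι n.
  N-* : ∀ z w → N (z *ᵍ w) ≡ N z * N w
  N-* (a + b i) (c + d i) = brahmagupta a b c d
    where
    brahmagupta : ∀ a b c d → (a * c - b * d) * (a * c - b * d) + (a * d + b * c) * (a * d + b * c)
                              ≡ (a * a + b * b) * (c * c + d * d)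
    brahmagupta = solve-∀

  N[z²-1]≡[Nz-1]²+4imz² : ∀ z →
    N (z *ᵍ z -ᵍ ι (+ 1)) ≡ (N z - + 1) * (N z - + 1) + + 4 * (im z * im z)
  N[z²-1]≡[Nz-1]²+4imz² (x + y i) = identity x y
    where
    identity : ∀ x y →
      (x * x - y * y - + 1) * (x * x - y * y - + 1) + (x * y + y * x - + 0) * (x * y + y * x - + 0)
      ≡ (x * x + y * y - + 1) * (x * x + y * y - + 1) + + 4 * (y * y)
    identity = solve-∀

  N[z²-1]+4rez²≡[Nz+1]² : ∀ z →
    N (z *ᵍ z -ᵍ ι (+ 1)) + + 4 * (re z * re z) ≡ (N z + + 1) * (N z + + 1)
  N[z²-1]+4rez²≡[Nz+1]² (x + y i) = identity x y
    where
    identity : ∀ x y →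
      (x * x - y * y - + 1) * (x * x - y * y - + 1) + (x * y + y * x - + 0) * (x * y + y * x - + 0)
        + + 4 * (x * x)
      ≡ (x * x + y * y + + 1) * (x * x + y * y + + 1)
    identity = solve-∀

  j≢0⇒j*j≡+[1+n] : ∀ {j} → j ≢ + 0 → ∃[ n ] j * j ≡ +[1+ n ]
  j≢0⇒j*j≡+[1+n] {+0}       j≢0 = contradiction refl j≢0
  j≢0⇒j*j≡+[1+n] {+[1+ n ]} _   = _ , +◃n≡+n (ℕ.suc n ℕ.* ℕ.suc n)
  j≢0⇒j*j≡+[1+n] { -[1+ n ]} _  = _ , +◃n≡+n (ℕ.suc n ℕ.* ℕ.suc n)

  ¬IsSquare∣N[z²-1]∣ : ∀ z → re z ≢ + 0 → im z ≢ + 0 → ¬ IsSquare ∣ N (z *ᵍ z -ᵍ ι (+ 1)) ∣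
  ¬IsSquare∣N[z²-1]∣ z@(x + y i) x≢0 y≢0
    with A , x*x≡1+A ← j≢0⇒j*j≡+[1+n] x≢0 | B , y*y≡1+B ← j≢0⇒j*j≡+[1+n] y≢0
    = subst (¬_ ∘ IsSquare) (cong ∣_∣ (sym P≡)) (¬IsSquare[t*t+4*[1+v]] t A B (+-injective upper))
    where
    t = A ℕ.+ ℕ.suc B
    P = N (z *ᵍ z -ᵍ ι (+ 1))
    P≡ : P ≡ + (t ℕ.* t ℕ.+ 4 ℕ.* ℕ.suc B)
    P≡ = begin
      P                                            ≡⟨ N[z²-1]≡[Nz-1]²+4imz² z ⟩
      (x * x + y * y - + 1) * (x * x + y * y - + 1) + + 4 * (y * y)
        ≡⟨ cong₂ (λ u v → (u + v - + 1) * (u + v - + 1) + + 4 * v) x*x≡1+A y*y≡1+B ⟩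
      + t * + t + + 4 * +[1+ B ]                   ≡⟨ cong₂ _+_ (pos-* t t) (pos-* 4 (ℕ.suc B)) ⟨
      + (t ℕ.* t ℕ.+ 4 ℕ.* ℕ.suc B)                ∎
    upper : + (t ℕ.* t ℕ.+ 4 ℕ.* ℕ.suc B ℕ.+ 4 ℕ.* ℕ.suc A) ≡ + ((2 ℕ.+ t) ℕ.* (2 ℕ.+ t))
    upper = begin
      + (t ℕ.* t ℕ.+ 4 ℕ.* ℕ.suc B) + + (4 ℕ.* ℕ.suc A)
        ≡⟨ cong₂ _+_ (sym P≡) (pos-* 4 (ℕ.suc A)) ⟩
      P + + 4 * +[1+ A ]                           ≡⟨ cong (λ u → P + + 4 * u) x*x≡1+A ⟨
      P + + 4 * (x * x)                            ≡⟨ N[z²-1]+4rez²≡[Nz+1]² z ⟩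
      (x * x + y * y + + 1) * (x * x + y * y + + 1)
        ≡⟨ cong₂ (λ u v → (u + v + + 1) * (u + v + + 1)) x*x≡1+A y*y≡1+B ⟩
      + (ℕ.suc A ℕ.+ ℕ.suc B ℕ.+ 1) * + (ℕ.suc A ℕ.+ ℕ.suc B ℕ.+ 1)
        ≡⟨ cong (λ n → + n * + n) (ℕ.+-comm (ℕ.suc A ℕ.+ ℕ.suc B) 1) ⟩
      + (2 ℕ.+ t) * + (2 ℕ.+ t)                    ≡⟨ pos-* (2 ℕ.+ t) (2 ℕ.+ t) ⟨
      + ((2 ℕ.+ t) ℕ.* (2 ℕ.+ t))                  ∎

  f-components : ∀ a b → f (a + b i) ≡ (+ 4 * a * (+ 4 * a * a - + 12 * b * b - + 1))
                                  + (+ 4 * b * (+ 12 * a * a - + 4 * b * b - + 1)) i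
  f-components a b = cong₂ _+_i (re-identity a b) (im-identity a b)
    where
    re-identity : ∀ a b →
      ((+ 16 * a - + 0 * b) * a - (+ 16 * b + + 0 * a) * b) * a
        - ((+ 16 * a - + 0 * b) * b + (+ 16 * b + + 0 * a) * a) * b - (+ 4 * a - + 0 * b)
      ≡ + 4 * a * (+ 4 * a * a - + 12 * b * b - + 1)
    re-identity = solve-∀
    im-identity : ∀ a b →
      ((+ 16 * a - + 0 * b) * a - (+ 16 * b + + 0 * a) * b) * b
        + ((+ 16 * a - + 0 * b) * b + (+ 16 * b + + 0 * a) * a) * a - (+ 4 * b + + 0 * a)
      ≡ + 4 * b * (+ 12 * a * a - + 4 * b * b - + 1)
    im-identity = solve-∀

  -- w k = 4k² − 2k − 1
  w : ℤ[i] → ℤ[i]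
  w (a + b i) = (+ 4 * (a * a - b * b) - + 2 * a - + 1) + (+ 2 * b * (+ 4 * a - + 1)) i

  f[k]*[k-1]≡w²-1 : ∀ k → f k *ᵍ (k -ᵍ ι (+ 1)) ≡ w k *ᵍ w k -ᵍ ι (+ 1)
  f[k]*[k-1]≡w²-1 k@(a + b i) =
    trans (cong (_*ᵍ (k -ᵍ ι (+ 1))) (f-components a b))
          (cong₂ _+_i (re-identity a b) (im-identity a b))
    where
    re-identity : ∀ a b →
      + 4 * a * (+ 4 * a * a - + 12 * b * b - + 1) * (a - + 1)
        - + 4 * b * (+ 12 * a * a - + 4 * b * b - + 1) * (b - + 0)
      ≡ (+ 4 * (a * a - b * b) - + 2 * a - + 1) * (+ 4 * (a * a - b * b) - + 2 * a - + 1)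
        - + 2 * b * (+ 4 * a - + 1) * (+ 2 * b * (+ 4 * a - + 1)) - + 1
    re-identity = solve-∀
    im-identity : ∀ a b →
      + 4 * a * (+ 4 * a * a - + 12 * b * b - + 1) * (b - + 0)
        + + 4 * b * (+ 12 * a * a - + 4 * b * b - + 1) * (a - + 1)
      ≡ (+ 4 * (a * a - b * b) - + 2 * a - + 1) * (+ 2 * b * (+ 4 * a - + 1))
        + + 2 * b * (+ 4 * a - + 1) * (+ 4 * (a * a - b * b) - + 2 * a - + 1) - + 0
    im-identity = solve-∀

  N[fk]*N[k-1]≡N[w²-1] : ∀ k → N (f k) * N (k -ᵍ ι (+ 1)) ≡ N (w k *ᵍ w k -ᵍ ι (+ 1))
  N[fk]*N[k-1]≡N[w²-1] k = trans (sym (N-* (f k) (k -ᵍ ι (+ 1)))) (cong N (f[k]*[k-1]≡w²-1 k))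

  2j+1≢0 : ∀ j → + 2 * j + + 1 ≢ + 0
  2j+1≢0 j 2j+1≡0 = ℕ.even≢odd ∣ j ∣ 0 (begin
    2 ℕ.* ∣ j ∣   ≡⟨ abs-* (+ 2) j ⟨
    ∣ + 2 * j ∣   ≡⟨ cong ∣_∣ 2j≡-1 ⟩
    1             ∎)
    where
    2j≡-1 : + 2 * j ≡ - + 1
    2j≡-1 = begin
      + 2 * j              ≡⟨ solve (j ∷ []) ⟩
      + 2 * j + + 1 - + 1  ≡⟨ cong (_- + 1) 2j+1≡0 ⟩
      - + 1                ∎

  re[w]≢0 : ∀ k → re (w k) ≢ + 0
  re[w]≢0 (a + b i) = 2j+1≢0 (+ 2 * (a * a - b * b) - a - + 1) ∘ trans (sym (re[w]≡2j+1 a b))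
    where
    re[w]≡2j+1 : ∀ a b →
      + 4 * (a * a - b * b) - + 2 * a - + 1 ≡ + 2 * (+ 2 * (a * a - b * b) - a - + 1) + + 1
    re[w]≡2j+1 = solve-∀

  im[w]≢0 : ∀ k → im k ≢ + 0 → im (w k) ≢ + 0
  im[w]≢0 (a + b i) b≢0 =
    [ 2b≢0 , 2j+1≢0 (+ 2 * a - + 1) ∘ trans (sym (4a-1≡2j+1 a)) ]′ ∘ i*j≡0⇒i≡0∨j≡0 (+ 2 * b)
    where
    4a-1≡2j+1 : ∀ a → + 4 * a - + 1 ≡ + 2 * (+ 2 * a - + 1) + + 1
    4a-1≡2j+1 = solve-∀
    2b≢0 : + 2 * b ≢ + 0
    2b≢0 = [ (λ ()) , b≢0 ]′ ∘ i*j≡0⇒i≡0∨j≡0 (+ 2)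

open Squares using (IsSquare)
open RationalSquares using (q*q*D≡F⇒IsSquare∣F*D∣)
open GaussianIntegers using (w; N[fk]*N[k-1]≡N[w²-1]; ¬IsSquare∣N[z²-1]∣; re[w]≢0; im[w]≢0)
open import Data.Integer using (+_; ∣_∣)
open import Data.Rational using (ℚ; _/_; _*_; _≤_; 0ℚ)

lemma7p6 : (k : ℤ[i]) → im k ≢ + 0 →
    ¬ (∃ λ (q : ℚ) → 0ℚ ≤ q × q * q * (N (k -ᵍ ι (+ 1)) / 1) ≡ N (f k) / 1)
lemma7p6 k Im[k]≢0 (q , _ , q²N[k-1]≡N[fk]) =
  ¬IsSquare∣N[z²-1]∣ (w k) (re[w]≢0 k) (im[w]≢0 k Im[k]≢0)
    (subst (IsSquare ∘ ∣_∣) (N[fk]*N[k-1]≡N[w²-1] k)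
           (q*q*D≡F⇒IsSquare∣F*D∣ q (N (k -ᵍ ι (+ 1))) (N (f k)) q²N[k-1]≡N[fk]))
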